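{- Let $p\ge 2$ and $t\ge1$ be integers and let $P_p$ be any ordered $2$-uniform path on $p$ vertices (a graph on $p$ vertices whose edges form a Hamiltonian path, with an arbitrary total order on its vertices). Then \[ R_{<,t}(P_p)\leq 2^{\frac{1}{\lceil\log_2 p\rceil}\left((\lceil\log_2 p\rceil+1)^{t-1}(\lceil\log_2 p\rceil^2-1)+1\right)}=2^{O\left(\log_2^t p\right)}. \]
   Context: An ordered graph is a graph with a totally ordered vertex set. An ordered graph $G$ is contained in an ordered graph $H$ if there is an injective order-preserving map $V(G)\to V(H)$ sending edges of $G$ to edges of $H$. $K_N$ is the complete graph on $[N]=\{1,\dots,N\}$ with the natural order. $R_{<,t}(G)$ is the least $N$ such that every coloring $c:E(K_N)\to[t]$ has a color class containing $G$. -}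

module Defs where

open import Data.Nat using (ℕ; zero; suc; _+_; _*_; _∸_; _^_; _/_)
open import Data.Nat.Logarithm using (⌈log₂_⌉)
open import Data.Fin using (Fin; toℕ; _<_)
open import Data.Fin.Permutation using (Permutation′; _⟨$⟩ʳ_)
open import Data.Product using (Σ; _×_; ∃)
open import Data.Sum using (_⊎_)
open import Relation.Binary.PropositionalEquality using (_≡_; _≢_)

-- An ordered graph on n vertices: vertex set Fin n with its natural order,
-- and an edge relation.
OrdGraph : ℕ → Set₁
OrdGraph n = Fin n → Fin n → Set

_⊑_ : ∀ {m n} → OrdGraph m → OrdGraph n → Set
_⊑_ {m} {n} G H =
  Σ (Fin m → Fin n) λ f →
    (∀ i j → i < j → f i < f j) × (∀ u v → G u v → H (f u) (f v))

-- The ordered path on vertex set Fin p visiting σ 0, σ 1, ..., σ (p-1)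
-- in this order (σ an arbitrary permutation of the vertices).
PathGraph : ∀ {p} → Permutation′ p → OrdGraph p
PathGraph {p} σ u v =
  Σ (Fin p) λ k → Σ (Fin p) λ k' → (toℕ k' ≡ suc (toℕ k)) ×
    ((u ≡ σ ⟨$⟩ʳ k × v ≡ σ ⟨$⟩ʳ k') ⊎ (u ≡ σ ⟨$⟩ʳ k' × v ≡ σ ⟨$⟩ʳ k))

-- A t-colouring of E(K_N), represented as a symmetric function
-- (values on the diagonal are irrelevant).
Colouring : ℕ → ℕ → Set
Colouring N t = Fin N → Fin N → Fin t

SymmetricColouring : ∀ {N t} → Colouring N t → Set
SymmetricColouring {N} c = ∀ (i j : Fin N) → c i j ≡ c j i

ColourClass : ∀ {N t} → Colouring N t → Fin t → OrdGraph N
ColourClass c χ u v = (u ≢ v) × (c u v ≡ χ)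

Arrows : ∀ {m} → ℕ → ℕ → OrdGraph m → Set
Arrows N t G =
  (c : Colouring N t) → SymmetricColouring c →
    ∃ λ (χ : Fin t) → G ⊑ ColourClass c χ

-- R_{<,t}(G) ≤ M  iff  some N ≤ M satisfies Arrows (R is the least such N).
RamseyLe : ∀ {m} → ℕ → OrdGraph m → ℕ → Set
RamseyLe t G M = Σ ℕ λ N → (N Data.Nat.≤ M) × Arrows N t G

-- Exponent ((L+1)^(t-1) (L^2-1) + 1) / L with L = ⌈log₂ p⌉
-- (an exact division; L ≥ 1 whenever p ≥ 2; the L = 0 branch is never used).
expo : ℕ → ℕ → ℕ
expo p t with ⌈log₂ p ⌉
... | zero  = 0
... | suc l = ((suc l + 1) ^ (t ∸ 1) * (suc l * suc l ∸ 1) + 1) / suc l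

module Submission where

open import Defs
open import Data.Nat using (ℕ; _≤_; _^_)
open import Data.Fin.Permutation using (Permutation′)

open import Data.Nat as ℕ using (zero; suc; _+_; _*_; _∸_; _/_; _≤?_; z≤n; s≤s; ⌈_/2⌉)
import Data.Nat.Properties as ℕ
open import Data.Nat.DivMod using (m*n/n≡m)
open import Data.Nat.Logarithm using (⌈log₂_⌉)
open import Data.Nat.Logarithm.Core using (⌈log2⌉)
open import Data.Nat.Tactic.RingSolver using (solve-∀)
open import Data.Fin using (Fin; zero; suc; inject₁; toℕ; fromℕ<) renaming (_<_ to _<ᶠ_)
import Data.Fin.Properties as Fin
open import Data.Fin.Permutation using (_⟨$⟩ʳ_; _⟨$⟩ˡ_; inverseʳ; inverseˡ)
open import Data.Vec.Functional using () renaming (_∷_ to _◂_)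
open import Data.List using (List; []; _∷_; length; take; drop; filter; _++_; allFin)
open import Data.List.Properties using (length-take; length-drop; length-++; length-tabulate)
open import Data.List.Membership.Propositional using (_∈_; find; lose)
open import Data.List.Membership.Propositional.Properties using (∈-filter⁻; ∈-++⁻)
open import Data.List.Relation.Binary.Subset.Propositional using (_⊆_)
open import Data.List.Relation.Binary.Subset.Propositional.Properties using (⊆-trans; filter-⊆)
open import Data.List.Relation.Binary.Sublist.Propositional.Properties
  using (Any-resp-⊆; take-⊆; drop-⊆)
import Data.List.Relation.Unary.All as All
open import Data.List.Relation.Unary.AllPairs using (AllPairs; []; _∷_)
import Data.List.Relation.Unary.AllPairs.Properties as AllPairs
open import Data.List.Relation.Unary.Any using (Any; any?; here; there)
open import Data.Empty using (⊥-elim)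
open import Data.Product using (Σ; ∃; _×_; _,_; proj₂)
open import Data.Sum using (_⊎_; inj₁; inj₂)
open import Induction.WellFounded using (Acc; acc)
open import Level using (0ℓ)
open import Relation.Binary.Core using (Rel)
open import Relation.Binary.Definitions using (Tri; tri<; tri≈; tri>)
open import Relation.Binary.PropositionalEquality
open import Relation.Nullary using (Dec; yes; no; contradiction)
open import Relation.Unary using (Pred; Decidable)
open import Relation.Unary.Properties using (∁?)

-- Fix a symmetric t-colouring c of K_N and the ordered path P on p = n + 1
-- vertices visiting σ(0), …, σ(n); vertex sets are sorted lists of Fin N.
--
-- * Greedy walk lemma (walks-or-obstruction): for sorted sets D₀, …, D_n of
--   more than 2s vertices, either some h₀ ∈ D₀ starts a walk h₀, …, h_n with
--   h_k ∈ D_k and all steps of colour χ, or two of the sets contain parts of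
--   more than s vertices with no χ-edge between them (an obstruction).
-- * Cut a sorted set W into consecutive blocks B₀ < … < B_n and take
--   D_k = B_{σ(k)}: a walk is an embedding of P in colour χ (walk-embeds),
--   an obstruction is a split of W into a left and a right part (obstruction-split).
-- * Erdős–Hajnal step (thin): if W uses only colours ≤ χ and has more than
--   threshold n m vertices, then P embeds in colour χ, or, thinning both sides
--   of a split recursively and merging them, W contains 2^m vertices that use
--   only colours < χ.
-- * Induction over the colours (force-path): with n + 1 ≤ 2^L, any 2^(e_j)
--   vertices using only colours < j force P, where e₀ = 1 and
--   e_{j+1} = (L+1)·e_j − 1 (threshold-fits-level).  For L = ⌈log₂ p⌉ the
--   closed form e_t = ((L+1)^(t-1)(L²-1)+1)/L (level-exponent) gives Theorem 7.

module _ {A : Set} where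

  ⊆-take : ∀ k (xs : List A) → take k xs ⊆ xs
  ⊆-take k xs = Any-resp-⊆ (take-⊆ k xs)

  ⊆-drop : ∀ k (xs : List A) → drop k xs ⊆ xs
  ⊆-drop k xs = Any-resp-⊆ (drop-⊆ k xs)

  nonempty : ∀ {s} {xs : List A} → suc s ≤ length xs → ∃ (_∈ xs)
  nonempty {xs = x ∷ _} _ = x , here refl

  take-before-drop : ∀ {R : Rel A 0ℓ} k {xs : List A} {x y} → AllPairs R xs →
                     x ∈ take k xs → y ∈ drop k xs → R x y
  take-before-drop (suc k) {_ ∷ _} (Rx ∷ _) (here refl) y∈ = All.lookup Rx (⊆-drop k _ y∈)
  take-before-drop (suc k) {_ ∷ _} (_ ∷ R-xs) (there x∈) y∈ = take-before-drop k R-xs x∈ y∈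

  block : ∀ {k} → ℕ → List A → Fin k → List A
  block B W zero    = take B W
  block B W (suc i) = block B (drop B W) i

  block-⊆ : ∀ {k} B W (i : Fin k) → block B W i ⊆ W
  block-⊆ B W zero    = ⊆-take B W
  block-⊆ B W (suc i) = ⊆-trans (block-⊆ B (drop B W) i) (⊆-drop B W)

  block-sorted : ∀ {R : Rel A 0ℓ} {k} B {W} (i : Fin k) → AllPairs R W → AllPairs R (block B W i)
  block-sorted B zero    R-W = AllPairs.take⁺ B R-W
  block-sorted B (suc i) R-W = block-sorted B i (AllPairs.drop⁺ B R-W)

  block-before : ∀ {R : Rel A 0ℓ} {k} B {W} {i j : Fin k} {x y} → AllPairs R W →
                 i <ᶠ j → x ∈ block B W i → y ∈ block B W j → R x y
  block-before B {W} {zero}  {suc j} R-W _ x∈ y∈ =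
    take-before-drop B R-W x∈ (block-⊆ B (drop B W) j y∈)
  block-before B {W} {suc i} {suc j} R-W (s≤s i<j) x∈ y∈ =
    block-before B (AllPairs.drop⁺ B R-W) i<j x∈ y∈

  block-length : ∀ {k} B W → k * B ≤ length W → (i : Fin k) → B ≤ length (block B W i)
  block-length {suc k} B W long zero = begin
    B                     ≡⟨ sym (ℕ.m≤n⇒m⊓n≡m (ℕ.≤-trans (ℕ.m≤m+n B _) long)) ⟩
    B ℕ.⊓ length W       ≡⟨ sym (length-take B W) ⟩
    length (take B W)     ∎
    where open ℕ.≤-Reasoning
  block-length {suc k} B W long (suc i) = block-length B (drop B W) rest-long i
    where
    rest-long : k * B ≤ length (drop B W)
    rest-long = begin
      k * B                 ≡⟨ sym (ℕ.m+n∸m≡n B (k * B)) ⟩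
      suc k * B ∸ B         ≤⟨ ℕ.∸-monoˡ-≤ B long ⟩
      length W ∸ B          ≡⟨ sym (length-drop B W) ⟩
      length (drop B W)     ∎
      where open ℕ.≤-Reasoning

  length-filter-split : ∀ {P : Pred A 0ℓ} (P? : Decidable P) xs →
                        length (filter P? xs) + length (filter (∁? P?) xs) ≡ length xs
  length-filter-split P? [] = refl
  length-filter-split P? (x ∷ xs) with P? x
  ... | yes _ = cong suc (length-filter-split P? xs)
  ... | no _  = trans (ℕ.+-suc _ _) (cong suc (length-filter-split P? xs))


  filter-complement-large : ∀ {P : Pred A 0ℓ} (P? : Decidable P) s (xs : List A) →
    suc (s + s) ≤ length xs → length (filter P? xs) ≤ s → suc s ≤ length (filter (∁? P?) xs)
  filter-complement-large P? s xs long few = ℕ.+-cancelˡ-≤ a (suc s) b (begin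
    a + suc s            ≤⟨ ℕ.+-monoˡ-≤ (suc s) few ⟩
    s + suc s            ≡⟨ ℕ.+-suc s s ⟩
    suc (s + s)          ≤⟨ long ⟩
    length xs            ≡⟨ sym (length-filter-split P? xs) ⟩
    a + b                ∎)
    where
    open ℕ.≤-Reasoning
    a = length (filter P? xs)
    b = length (filter (∁? P?) xs)

increasing-injective : ∀ {m n} (f : Fin m → Fin n) → (∀ a b → a <ᶠ b → f a <ᶠ f b) →
                       ∀ {a b} → a ≢ b → f a ≢ f b
increasing-injective f inc {a} {b} a≢b with Fin.<-cmp a b
... | tri< a<b _ _ = Fin.<⇒≢ (inc a b a<b)
... | tri≈ _ a≡b _ = ⊥-elim (a≢b a≡b)
... | tri> _ _ b<a = λ fa≡fb → Fin.<⇒≢ (inc b a b<a) (sym fa≡fb)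

consecutive : ∀ {n} (k k′ : Fin (suc n)) → toℕ k′ ≡ suc (toℕ k) →
              Σ (Fin n) λ i → k ≡ inject₁ i × k′ ≡ suc i
consecutive k (suc i) k′≡1+k =
  i , Fin.toℕ-injective (trans (ℕ.suc-injective (sym k′≡1+k)) (sym (Fin.toℕ-inject₁ i))) , refl

permutation-injective : ∀ {n} (σ : Permutation′ n) {a b} → σ ⟨$⟩ʳ a ≡ σ ⟨$⟩ʳ b → a ≡ b
permutation-injective σ {a} {b} σa≡σb = begin
  a                      ≡⟨ sym (inverseˡ σ) ⟩
  σ ⟨$⟩ˡ (σ ⟨$⟩ʳ a)      ≡⟨ cong (σ ⟨$⟩ˡ_) σa≡σb ⟩
  σ ⟨$⟩ˡ (σ ⟨$⟩ʳ b)      ≡⟨ inverseˡ σ ⟩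
  b                      ∎
  where open ≡-Reasoning

-- The Erdős–Hajnal step for m halvings needs more than threshold n m
-- vertices: threshold n (m+1) + 1 = (n+1)·(2·threshold n m + 1), i.e. n + 1
-- blocks, each large enough to hold two halves of more than threshold n m.
threshold : ℕ → ℕ → ℕ
threshold n zero    = 0
threshold n (suc m) = (threshold n m + threshold n m) + n * suc (threshold n m + threshold n m)

-- level l j = e_j − 1 where, with L = l + 1, e₀ = 1 and e_{j+1} = (L+1)·e_j − 1:
-- 2^(e_j) vertices using only colours < j will force the path.
level : ℕ → ℕ → ℕ
level l zero    = 0
level l (suc j) = suc (suc l) * level l j + l

blocks-fit : ∀ n L → suc n ≤ 2 ^ L → ∀ m →
  suc (threshold n m + threshold n m) ≤ 2 ^ (suc L * m)
blocks-fit n L fit zero = ℕ.≤-reflexive (cong (2 ^_) (sym (ℕ.*-zeroʳ L)))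
blocks-fit n L fit (suc m) = begin
  suc (T′ + T′)                       ≤⟨ s≤s (ℕ.+-monoʳ-≤ T′ (ℕ.n≤1+n T′)) ⟩
  suc T′ + suc T′                     ≡⟨ cong (suc T′ +_) (sym (ℕ.+-identityʳ _)) ⟩
  2 * (suc n * suc (T + T))           ≤⟨ ℕ.*-monoʳ-≤ 2 (ℕ.*-mono-≤ fit (blocks-fit n L fit m)) ⟩
  2 * (2 ^ L * 2 ^ (suc L * m))       ≡⟨ cong (2 *_) (sym (ℕ.^-distribˡ-+-* 2 L _)) ⟩
  2 ^ (suc L + suc L * m)             ≡⟨ cong (2 ^_) (sym (ℕ.*-suc (suc L) m)) ⟩
  2 ^ (suc L * suc m)                 ∎
  where
  open ℕ.≤-Reasoning
  T  = threshold n m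
  T′ = threshold n (suc m)

-- Hence 2^(e_{j+1}) vertices exceed the threshold for e_j halvings: thinning
-- out one colour from 2^(e_{j+1}) vertices leaves 2^(e_j) vertices.
threshold-fits-level : ∀ n l → suc n ≤ 2 ^ suc l → ∀ j →
  suc (threshold n (suc (level l j))) ≤ 2 ^ suc (level l (suc j))
threshold-fits-level n l fit j = begin
  suc n * suc (T + T)                         ≤⟨ ℕ.*-mono-≤ fit (blocks-fit n (suc l) fit (level l j)) ⟩
  2 ^ suc l * 2 ^ (suc (suc l) * level l j)   ≡⟨ sym (ℕ.^-distribˡ-+-* 2 (suc l) _) ⟩
  2 ^ (suc l + suc (suc l) * level l j)       ≡⟨ cong (λ e → 2 ^ suc e) (ℕ.+-comm l _) ⟩
  2 ^ suc (level l (suc j))                   ∎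
  where
  open ℕ.≤-Reasoning
  T = threshold n (level l j)

module ColourWalks {N t : ℕ} (c : Colouring N t) (c-sym : SymmetricColouring c) where

  Sorted : List (Fin N) → Set
  Sorted = AllPairs _<ᶠ_

  record SortedPart (b : ℕ) (V : List (Fin N)) : Set where
    field
      vertices : List (Fin N)
      sorted   : Sorted vertices
      within   : vertices ⊆ V
      large    : b ≤ length vertices

  widen : ∀ {b V W} → V ⊆ W → SortedPart b V → SortedPart b W
  widen V⊆W P = record { vertices = vertices ; sorted = sorted ; within = λ x∈ → V⊆W (within x∈) ; large = large }
    where open SortedPart P

  Walk : Fin t → ∀ {m} → (Fin (suc m) → List (Fin N)) → Fin N → Set
  Walk χ {m} D y = Σ (Fin (suc m) → Fin N) λ h →
    h zero ≡ y × (∀ k → h k ∈ D k) × (∀ (i : Fin m) → c (h (inject₁ i)) (h (suc i)) ≡ χ)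

  record ManyStarts (χ : Fin t) (s : ℕ) {m} (D : Fin (suc m) → List (Fin N)) : Set where
    field
      starts : SortedPart (suc s) (D zero)
      walk   : ∀ {y} → y ∈ SortedPart.vertices starts → Walk χ D y

  record Obstruction (χ : Fin t) (s : ℕ) {m} (D : Fin (suc m) → List (Fin N)) : Set where
    field
      i j   : Fin (suc m)
      i≢j   : i ≢ j
      X     : SortedPart (suc s) (D i)
      Y     : SortedPart (suc s) (D j)
      no-χ  : ∀ {x y} → x ∈ SortedPart.vertices X → y ∈ SortedPart.vertices Y → c x y ≢ χ

  some-walk : ∀ {χ s m} {D : Fin (suc m) → List (Fin N)} → ManyStarts χ s D → ∃ (Walk χ D)
  some-walk S = let (y , y∈) = nonempty (SortedPart.large (ManyStarts.starts S)) in y , ManyStarts.walk S y∈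

  module _ (χ : Fin t) (s : ℕ) where

    obstruction-suc : ∀ {m} {D : Fin (suc (suc m)) → List (Fin N)} →
                      Obstruction χ s (λ k → D (suc k)) → Obstruction χ s D
    obstruction-suc o = record
      { i = suc i ; j = suc j ; i≢j = λ e → i≢j (Fin.suc-injective e) ; X = X ; Y = Y ; no-χ = no-χ }
      where open Obstruction o

    walk-cons : ∀ {m} {D : Fin (suc (suc m)) → List (Fin N)} {x y} →
                y ∈ D zero → c y x ≡ χ → Walk χ (λ k → D (suc k)) x → Walk χ D y
    walk-cons {D = D} {x} {y} y∈ yx (h , refl , h∈ , steps) = y ◂ h , refl , ∈D , steps′
      where
      ∈D : ∀ k → (y ◂ h) k ∈ D k
      ∈D zero    = y∈
      ∈D (suc k) = h∈ k
      steps′ : ∀ i → c ((y ◂ h) (inject₁ i)) ((y ◂ h) (suc i)) ≡ χ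
      steps′ zero    = yx
      steps′ (suc i) = steps i

    linked? : (C : List (Fin N)) → Decidable (λ y → Any (λ x → c y x ≡ χ) C)
    linked? C y = any? (λ x → c y x Fin.≟ χ) C

    -- One step of the greedy construction: given many starts of χ-walks
    -- through D₁,…,D_m, either many y ∈ D₀ have a χ-edge to one of them,
    -- or the vertices of D₀ without such an edge form an obstruction with them.
    extend : ∀ {m} (D : Fin (suc (suc m)) → List (Fin N)) → Sorted (D zero) →
             suc (s + s) ≤ length (D zero) → ManyStarts χ s (λ k → D (suc k)) →
             ManyStarts χ s D ⊎ Obstruction χ s D
    extend D sorted-D₀ long-D₀ S = decide (suc s ≤? length linked)
      where
      open ManyStarts S
      C = SortedPart.vertices starts
      linked   = filter (linked? C) (D zero)
      unlinked = filter (∁? (linked? C)) (D zero)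
      decide : Dec (suc s ≤ length linked) → ManyStarts χ s D ⊎ Obstruction χ s D
      decide (yes many) = inj₁ record
        { starts = record { vertices = linked ; sorted = AllPairs.filter⁺ (linked? C) sorted-D₀
                          ; within = filter-⊆ (linked? C) (D zero) ; large = many }
        ; walk = λ y∈ → let (y∈D₀ , link) = ∈-filter⁻ (linked? C) {xs = D zero} y∈ ; (x , x∈ , yx) = find link
                        in walk-cons y∈D₀ yx (walk x∈) }
      decide (no few) = inj₂ record
        { i = suc zero ; j = zero ; i≢j = λ ()
        ; X = starts
        ; Y = record { vertices = unlinked ; sorted = AllPairs.filter⁺ (∁? (linked? C)) sorted-D₀
                     ; within = filter-⊆ (∁? (linked? C)) (D zero)
                     ; large = filter-complement-large (linked? C) s (D zero) long-D₀ (ℕ.≤-pred (ℕ.≰⇒> few)) }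
        ; no-χ = λ x∈ y∈ xy → proj₂ (∈-filter⁻ (∁? (linked? C)) {xs = D zero} y∈) (lose x∈ (trans (c-sym _ _) xy)) }

    walks-or-obstruction : ∀ m (D : Fin (suc m) → List (Fin N)) → (∀ k → Sorted (D k)) →
                           (∀ k → suc (s + s) ≤ length (D k)) → ManyStarts χ s D ⊎ Obstruction χ s D
    walks-or-obstruction zero D sorted long = inj₁ record
      { starts = record { vertices = D zero ; sorted = sorted zero ; within = λ y∈ → y∈
                        ; large = ℕ.≤-trans (ℕ.s≤s (ℕ.m≤m+n s s)) (long zero) }
      ; walk = λ {y} y∈ → (λ _ → y) , refl , (λ { zero → y∈ }) , (λ ()) }
    walks-or-obstruction (suc m) D sorted long
      with walks-or-obstruction m (λ k → D (suc k)) (λ k → sorted (suc k)) (λ k → long (suc k))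
    ... | inj₁ S = extend D (sorted zero) (long zero) S
    ... | inj₂ o = inj₂ (obstruction-suc o)

  ColoursBelow : ℕ → List (Fin N) → Set
  ColoursBelow k V = ∀ {x y} → x ∈ V → y ∈ V → x ≢ y → toℕ (c x y) ℕ.< k

  below-⊆ : ∀ {k V W} → V ⊆ W → ColoursBelow k W → ColoursBelow k V
  below-⊆ V⊆W low x∈ y∈ = low (V⊆W x∈) (V⊆W y∈)

  LowPart : ℕ → ℕ → List (Fin N) → Set
  LowPart k b W = Σ (SortedPart b W) λ P → ColoursBelow k (SortedPart.vertices P)

  record Split (χ : Fin t) (s : ℕ) (W : List (Fin N)) : Set where
    field
      left right : SortedPart (suc s) W
      before     : ∀ {x y} → x ∈ SortedPart.vertices left → y ∈ SortedPart.vertices right → x <ᶠ y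
      no-χ       : ∀ {x y} → x ∈ SortedPart.vertices left → y ∈ SortedPart.vertices right → c x y ≢ χ

  -- Doubling step of the Erdős–Hajnal argument: inside a split of a set with
  -- colours ≤ χ, parts of size 2^m with colours < χ on either side join to a
  -- part of size 2^(m+1) with colours < χ, since the edges across avoid χ.
  merge : ∀ {χ s m W} → ColoursBelow (suc (toℕ χ)) W → (S : Split χ s W) →
          LowPart (toℕ χ) (2 ^ m) (SortedPart.vertices (Split.left S)) →
          LowPart (toℕ χ) (2 ^ m) (SortedPart.vertices (Split.right S)) →
          LowPart (toℕ χ) (2 ^ suc m) W
  merge {χ} {m = m} {W} low-W S (A , low-A) (B , low-B) =
    record { vertices = VA ++ VB ; sorted = sorted-AB ; within = within-AB ; large = large-AB } , low-AB
    where
    open Split S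
    open SortedPart A using () renaming (vertices to VA; within to A⊆; sorted to sorted-A; large to large-A)
    open SortedPart B using () renaming (vertices to VB; within to B⊆; sorted to sorted-B; large to large-B)
    L⊆W = SortedPart.within left
    R⊆W = SortedPart.within right
    sorted-AB : Sorted (VA ++ VB)
    sorted-AB = AllPairs.++⁺ sorted-A sorted-B
      (All.tabulate (λ x∈ → All.tabulate (λ y∈ → before (A⊆ x∈) (B⊆ y∈))))
    within-AB : VA ++ VB ⊆ W
    within-AB z∈ with ∈-++⁻ VA z∈
    ... | inj₁ z∈A = L⊆W (A⊆ z∈A)
    ... | inj₂ z∈B = R⊆W (B⊆ z∈B)
    large-AB : 2 ^ suc m ≤ length (VA ++ VB)
    large-AB = begin
      2 ^ m + (2 ^ m + 0)       ≤⟨ ℕ.+-mono-≤ large-A (ℕ.≤-reflexive (ℕ.+-identityʳ _)) ⟩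
      length VA + 2 ^ m         ≤⟨ ℕ.+-monoʳ-≤ (length VA) large-B ⟩
      length VA + length VB     ≡⟨ sym (length-++ VA) ⟩
      length (VA ++ VB)         ∎
      where open ℕ.≤-Reasoning
    -- an edge across the split has colour ≤ χ but not χ
    across : ∀ {x y} → x ∈ VA → y ∈ VB → x ≢ y → toℕ (c x y) ℕ.< toℕ χ
    across x∈ y∈ x≢y = ℕ.≤∧≢⇒< (ℕ.≤-pred (low-W (L⊆W (A⊆ x∈)) (R⊆W (B⊆ y∈)) x≢y))
                                (λ e → no-χ (A⊆ x∈) (B⊆ y∈) (Fin.toℕ-injective e))
    low-AB : ColoursBelow (toℕ χ) (VA ++ VB)
    low-AB x∈ y∈ x≢y with ∈-++⁻ VA x∈ | ∈-++⁻ VA y∈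
    ... | inj₁ x∈A | inj₁ y∈A = low-A x∈A y∈A x≢y
    ... | inj₂ x∈B | inj₂ y∈B = low-B x∈B y∈B x≢y
    ... | inj₁ x∈A | inj₂ y∈B = across x∈A y∈B x≢y
    ... | inj₂ x∈B | inj₁ y∈A = subst (ℕ._< toℕ χ) (cong toℕ (c-sym _ _)) (across y∈A x∈B (λ e → x≢y (sym e)))

module PathInColouring {N t : ℕ} (c : Colouring N t) (c-sym : SymmetricColouring c)
                       {n : ℕ} (σ : Permutation′ (suc n)) where

  open ColourWalks c c-sym

  Embeds : Fin t → Set
  Embeds χ = PathGraph σ ⊑ ColourClass c χ

  -- A χ-walk through ordered blocks B_{σ(0)}, …, B_{σ(n)} realises the path
  -- in colour χ: vertex v is sent to the walk's vertex in block B_v.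
  walk-embeds : (χ : Fin t) (B : Fin (suc n) → List (Fin N)) →
                (∀ {a b x y} → a <ᶠ b → x ∈ B a → y ∈ B b → x <ᶠ y) →
                ∀ {y} → Walk χ (λ k → B (σ ⟨$⟩ʳ k)) y → Embeds χ
  walk-embeds χ B ordered (h , _ , h∈ , steps) = f , increasing , edge
    where
    f : Fin (suc n) → Fin N
    f v = h (σ ⟨$⟩ˡ v)
    f∈ : ∀ v → f v ∈ B v
    f∈ v = subst (λ w → f v ∈ B w) (inverseʳ σ) (h∈ (σ ⟨$⟩ˡ v))
    increasing : ∀ a b → a <ᶠ b → f a <ᶠ f b
    increasing a b a<b = ordered a<b (f∈ a) (f∈ b)
    f∘σ : ∀ k → f (σ ⟨$⟩ʳ k) ≡ h k
    f∘σ k = cong h (inverseˡ σ)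
    step : ∀ k k′ → toℕ k′ ≡ suc (toℕ k) → ColourClass c χ (f (σ ⟨$⟩ʳ k)) (f (σ ⟨$⟩ʳ k′))
    step k k′ k′≡1+k with consecutive k k′ k′≡1+k
    ... | i , refl , refl =
      increasing-injective f increasing (λ σk≡σk′ → ℕ.<⇒≢ (ℕ.n<1+n _)
        (trans (cong toℕ (permutation-injective σ σk≡σk′)) k′≡1+k)) ,
      trans (cong₂ c (f∘σ (inject₁ i)) (f∘σ (suc i))) (steps i)
    edge : ∀ u v → PathGraph σ u v → ColourClass c χ (f u) (f v)
    edge _ _ (k , k′ , k′≡1+k , inj₁ (refl , refl)) = step k k′ k′≡1+k
    edge _ _ (k , k′ , k′≡1+k , inj₂ (refl , refl)) =
      let (≢ , col) = step k k′ k′≡1+k in (λ e → ≢ (sym e)) , trans (c-sym _ _) col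

  obstruction-split : ∀ {χ s} (B : Fin (suc n) → List (Fin N)) {W} → (∀ a → B a ⊆ W) →
                      (∀ {a b x y} → a <ᶠ b → x ∈ B a → y ∈ B b → x <ᶠ y) →
                      Obstruction χ s (λ k → B (σ ⟨$⟩ʳ k)) → Split χ s W
  obstruction-split {χ} {s} B {W} B⊆W ordered o = orient (Fin.<-cmp (σ ⟨$⟩ʳ i) (σ ⟨$⟩ʳ j))
    where
    open Obstruction o
    X⊆ = SortedPart.within X
    Y⊆ = SortedPart.within Y
    orient : Tri (σ ⟨$⟩ʳ i <ᶠ σ ⟨$⟩ʳ j) (σ ⟨$⟩ʳ i ≡ σ ⟨$⟩ʳ j) (σ ⟨$⟩ʳ j <ᶠ σ ⟨$⟩ʳ i) → Split χ s W
    orient (tri< σi<σj _ _) = record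
      { left = widen (B⊆W _) X ; right = widen (B⊆W _) Y
      ; before = λ x∈ y∈ → ordered σi<σj (X⊆ x∈) (Y⊆ y∈) ; no-χ = no-χ }
    orient (tri≈ _ σi≡σj _) = ⊥-elim (i≢j (permutation-injective σ σi≡σj))
    orient (tri> _ _ σj<σi) = record
      { left = widen (B⊆W _) Y ; right = widen (B⊆W _) X
      ; before = λ y∈ x∈ → ordered σj<σi (Y⊆ y∈) (X⊆ x∈)
      ; no-χ = λ y∈ x∈ yx → no-χ x∈ y∈ (trans (c-sym _ _) yx) }

  -- Cut W into blocks B₀,…,B_n of size
  -- 2T+1 (T = threshold n (m-1)) and run the greedy walk through them in
  -- the order σ: a walk gives the path, an obstruction gives a split whose
  -- two sides are thinned recursively and merged.
  thin : (χ : Fin t) (m : ℕ) (W : List (Fin N)) → Sorted W → ColoursBelow (suc (toℕ χ)) W →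
         suc (threshold n m) ≤ length W → Embeds χ ⊎ LowPart (toℕ χ) (2 ^ m) W
  thin χ zero (w ∷ _) _ _ _ = inj₂ (singleton , λ { (here refl) (here refl) w≢w → ⊥-elim (w≢w refl) })
    where
    singleton : SortedPart 1 (w ∷ _)
    singleton = record
      { vertices = w ∷ [] ; sorted = All.[] ∷ [] ; within = λ { (here refl) → here refl } ; large = s≤s z≤n }
  thin χ (suc m) W sorted-W low-W long-W = conclude (walks-or-obstruction χ T n D sorted-D long-D)
    where
    T    = threshold n m
    size = suc (T + T)
    D    = λ k → block size W (σ ⟨$⟩ʳ k)
    sorted-D : ∀ k → Sorted (D k)
    sorted-D k = block-sorted size (σ ⟨$⟩ʳ k) sorted-W
    long-D : ∀ k → size ≤ length (D k)
    long-D k = block-length size W long-W (σ ⟨$⟩ʳ k)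
    ordered : ∀ {a b x y} → a <ᶠ b → x ∈ block size W a → y ∈ block size W b → x <ᶠ y
    ordered = block-before size sorted-W
    recurse : (P : SortedPart (suc T) W) → Embeds χ ⊎ LowPart (toℕ χ) (2 ^ m) (SortedPart.vertices P)
    recurse P = thin χ m vertices sorted (below-⊆ within low-W) large
      where open SortedPart P
    conclude : ManyStarts χ T D ⊎ Obstruction χ T D → Embeds χ ⊎ LowPart (toℕ χ) (2 ^ suc m) W
    conclude (inj₁ S) = inj₁ (walk-embeds χ (block size W) ordered (proj₂ (some-walk S)))
    conclude (inj₂ o) = combine (recurse (Split.left S)) (recurse (Split.right S))
      where
      S = obstruction-split (block size W) (block-⊆ size W) ordered o
      combine : Embeds χ ⊎ LowPart (toℕ χ) (2 ^ m) (SortedPart.vertices (Split.left S)) →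
                Embeds χ ⊎ LowPart (toℕ χ) (2 ^ m) (SortedPart.vertices (Split.right S)) →
                Embeds χ ⊎ LowPart (toℕ χ) (2 ^ suc m) W
      combine (inj₁ e) _        = inj₁ e
      combine (inj₂ _) (inj₁ e) = inj₁ e
      combine (inj₂ A) (inj₂ B) = inj₂ (merge {m = m} low-W S A B)

  -- For j = 0 the set cannot have two vertices; otherwise
  -- thinning out colour j - 1 either finds the path or leaves a large set
  -- using only colours < j - 1.
  force-path : ∀ l → suc n ≤ 2 ^ suc l → ∀ j → j ≤ t → (W : List (Fin N)) → Sorted W →
               ColoursBelow j W → 2 ^ suc (level l j) ≤ length W → ∃ Embeds
  force-path l fit zero _ (_ ∷ []) _ _ (s≤s ())
  force-path l fit zero _ (x ∷ y ∷ _) ((x<y All.∷ _) ∷ _) low _ =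
    ⊥-elim (ℕ.n≮0 (low (here refl) (there (here refl)) (Fin.<⇒≢ x<y)))
  force-path l fit (suc j) j<t W sorted-W low long = continue (thin χ (suc (level l j)) W sorted-W low-χ long-χ)
    where
    χ = fromℕ< j<t
    low-χ : ColoursBelow (suc (toℕ χ)) W
    low-χ = subst (λ k → ColoursBelow (suc k) W) (sym (Fin.toℕ-fromℕ< j<t)) low
    long-χ : suc (threshold n (suc (level l j))) ≤ length W
    long-χ = ℕ.≤-trans (threshold-fits-level n l fit j) long
    continue : Embeds χ ⊎ LowPart (toℕ χ) (2 ^ suc (level l j)) W → ∃ Embeds
    continue (inj₁ embeds)  = χ , embeds
    continue (inj₂ (P , low-P)) =
      force-path l fit j (ℕ.<⇒≤ j<t) vertices sorted low-below-j large
      where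
      open SortedPart P
      low-below-j : ColoursBelow j vertices
      low-below-j = subst (λ k → ColoursBelow k vertices) (Fin.toℕ-fromℕ< j<t) low-P

-- Closed form of the levels: e_{j+1}·L = (L+1)^j (L² − 1) + 1, written
-- with L = suc l and e_{j+1} = level l (suc j) + 1.
level-closed : ∀ l j → (suc l + 1) ^ j * (suc l * suc l ∸ 1) ≡ level l (suc j) * suc l + l
level-closed l zero = base l
  where
  base : ∀ l → 1 * (l + l * suc l) ≡ (suc (suc l) * 0 + l) * suc l + l
  base = solve-∀
level-closed l (suc j) = begin
  (suc l + 1) ^ suc j * X               ≡⟨ ℕ.*-assoc (suc l + 1) ((suc l + 1) ^ j) X ⟩
  (suc l + 1) * ((suc l + 1) ^ j * X)   ≡⟨ cong ((suc l + 1) *_) (level-closed l j) ⟩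
  (suc l + 1) * (e * suc l + l)         ≡⟨ regroup e l ⟩
  (suc (suc l) * e + l) * suc l + l     ∎
  where
  open ≡-Reasoning
  X = suc l * suc l ∸ 1
  e = level l (suc j)
  regroup : ∀ e l → (suc l + 1) * (e * suc l + l) ≡ (suc (suc l) * e + l) * suc l + l
  regroup = solve-∀

-- The exponent of Theorem 7 is exactly e_{t+1}: the division is exact.
level-exponent : ∀ l t → ((suc l + 1) ^ t * (suc l * suc l ∸ 1) + 1) / suc l ≡ suc (level l (suc t))
level-exponent l t = begin
  ((suc l + 1) ^ t * (suc l * suc l ∸ 1) + 1) / suc l   ≡⟨ cong (λ x → (x + 1) / suc l) (level-closed l t) ⟩
  (e * suc l + l + 1) / suc l                            ≡⟨ cong (_/ suc l) (regroup e l) ⟩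
  (suc e * suc l) / suc l                                 ≡⟨ m*n/n≡m (suc e) (suc l) ⟩
  suc e                                                   ∎
  where
  open ≡-Reasoning
  e = level l (suc t)
  regroup : ∀ e l → e * suc l + l + 1 ≡ suc e * suc l
  regroup = solve-∀

≤-2^⌈log2⌉ : ∀ n (rec : Acc ℕ._<_ n) → n ≤ 2 ^ ⌈log2⌉ n rec
≤-2^⌈log2⌉ zero          _ = z≤n
≤-2^⌈log2⌉ (suc zero)    _ = s≤s z≤n
≤-2^⌈log2⌉ (suc (suc n)) (acc rs) = begin
  suc (suc n)            ≤⟨ s≤s (s≤s n≤h+h) ⟩
  suc (suc (h + h))      ≡⟨ cong suc (sym (ℕ.+-suc h h)) ⟩
  suc h + suc h          ≤⟨ ℕ.+-mono-≤ ih ih ⟩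
  e + e                  ≡⟨ cong (e +_) (sym (ℕ.+-identityʳ e)) ⟩
  2 * e                  ∎
  where
  open ℕ.≤-Reasoning
  h  = ⌈ n /2⌉
  e  = 2 ^ ⌈log2⌉ (suc h) _
  ih = ≤-2^⌈log2⌉ (suc h) _
  n≤h+h : n ≤ h + h
  n≤h+h = subst (_≤ h + h) (ℕ.⌊n/2⌋+⌈n/2⌉≡n n) (ℕ.+-monoˡ-≤ h (ℕ.⌊n/2⌋≤⌈n/2⌉ n))

≤-2^⌈log₂⌉ : ∀ n → n ≤ 2 ^ ⌈log₂ n ⌉
≤-2^⌈log₂⌉ n = ≤-2^⌈log2⌉ n _

-- The path on n + 1 ≤ 2^(l+1) vertices is forced in K_N, N = 2^(level l t + 1):
-- all of K_N uses only the t colours available.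
path-arrows : ∀ {n} l t (σ : Permutation′ (suc n)) → suc n ≤ 2 ^ suc l →
              Arrows (2 ^ suc (level l t)) t (PathGraph σ)
path-arrows l t σ fit c c-sym =
  force-path l fit t ℕ.≤-refl (allFin _) (AllPairs.tabulate⁺-< (λ i<j → i<j))
    (λ _ _ _ → Fin.toℕ<n _) (ℕ.≤-reflexive (sym (length-tabulate (λ i → i))))
  where open PathInColouring c c-sym σ

theorem7 : (p t : ℕ) → 2 ≤ p → 1 ≤ t → (σ : Permutation′ p) →
    RamseyLe t (PathGraph σ) (2 ^ expo p t)
theorem7 (suc n) (suc t) 2≤p _ σ with ⌈log₂ suc n ⌉ | ≤-2^⌈log₂⌉ (suc n)
... | zero  | p≤1 = contradiction p≤1 (ℕ.<⇒≱ 2≤p)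
... | suc l | fit = 2 ^ suc (level l (suc t)) ,
                    ℕ.≤-reflexive (cong (2 ^_) (sym (level-exponent l t))) ,
                    path-arrows l (suc t) σ fit
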